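{- Let $G$ be a graph constructed, together with a coloring of its vertices, by the following procedure: (1) Construct an odd cycle and color its vertices blue. (2) Either perform step (3), or perform step (4), or stop. (3) Choose any existing vertex $u$, add two new vertices $u_1,u_2$ and edges $uu_1, u_1u_2$; color $u_1$ red and $u_2$ black; go to (2). (4) If there is no red vertex go to (2); otherwise choose a red vertex $u$, add a new vertex $u_1$ and the edge $uu_1$, color $u_1$ black; go to (2). Then there exists a maximum independent set of $G$ that contains all the black vertices of $G$.
   Context: All graphs are finite and simple. A maximum independent set is an independent set of largest possible size. -}

module Defs where

open import Data.Nat using (ℕ; zero; suc; _+_; _*_; _≤_)
open import Data.Fin using (Fin; zero; suc; inject₁; fromℕ)
open import Data.Fin.Subset using (Subset; _∈_; ∣_∣)
open import Data.List using (List; []; _∷_; map)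
open import Data.List.Relation.Unary.Any using (Any)
open import Data.List.Membership.Propositional using () renaming (_∈_ to _∈ₗ_)
open import Data.Product using (_×_; _,_; Σ-syntax)
open import Data.Sum using (_⊎_)
open import Relation.Nullary using (¬_)
open import Relation.Binary.PropositionalEquality using (_≡_)

data Colour : Set where
  blue red black : Colour

Edges : ℕ → Set
Edges n = List (Fin n × Fin n)

Adj : ∀ {n} → Edges n → Fin n → Fin n → Set
Adj E u v = ((u , v) ∈ₗ E) ⊎ ((v , u) ∈ₗ E)

-- Cycle on vertices 0,1,...,m (i.e. m+1 vertices):
-- edges i -- i+1 for i < m, and m -- 0.
pathEdges : ∀ m → Edges (suc m)
pathEdges zero = []
pathEdges (suc m) = (zero , suc zero) ∷ map (λ { (a , b) → (suc a , suc b) }) (pathEdges m)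

cycleEdges : ∀ m → Edges (suc m)
cycleEdges m = (fromℕ m , zero) ∷ pathEdges m

shift : ∀ {n} k → Edges n → Edges (k + n)
shift zero E = E
shift (suc k) E = map (λ { (a , b) → (suc a , suc b) }) (shift k E)

-- Graphs (with colourings) produced by the procedure of the paper.
-- New vertices are placed at the front (indices 0, 1), old vertex v is
-- renamed to suc v / suc (suc v).
data Built : (n : ℕ) → Edges n → (Fin n → Colour) → Set where
  cycle : ∀ k → Built (suc (suc (suc (2 * k)))) (cycleEdges (suc (suc (2 * k)))) (λ _ → blue)
  -- (3) pendant path u - u1 - u2, u1 red (= vertex 0), u2 black (= vertex 1)
  step3 : ∀ {n E col} → Built n E col → (u : Fin n) →
          Built (suc (suc n))
                ((suc (suc u) , zero) ∷ (zero , suc zero) ∷ shift 2 E)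
                (λ { zero → red ; (suc zero) → black ; (suc (suc v)) → col v })
  -- (4) pendant vertex u1 (= vertex 0, black) at a red vertex u
  step4 : ∀ {n E col} → Built n E col → (u : Fin n) → col u ≡ red →
          Built (suc n)
                ((suc u , zero) ∷ shift 1 E)
                (λ { zero → black ; (suc v) → col v })

Independent : ∀ {n} → Edges n → Subset n → Set
Independent E S = ∀ u v → u ∈ S → v ∈ S → ¬ Adj E u v

MaximumIndependent : ∀ {n} → Edges n → Subset n → Set
MaximumIndependent E S = Independent E S × (∀ T → Independent E T → ∣ T ∣ ≤ ∣ S ∣)

module Submission where

-- The procedure preserves the following invariant: some maximum independent set
-- contains every black vertex and no red vertex.  For the cycle on m + 1 vertices
-- take every second vertex, avoiding vertex 0: along the path 0 … m an independent
-- set T satisfies 2∣T∣ ≤ m + [0 ∈ T] + [m ∈ T], and the closing edge m – 0 forbids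
-- both endpoints, so 2∣T∣ ≤ m + 1 ≤ 2∣S∣ + 1.  Step (3) adds the black end u₂ of
-- the new path u – u₁ – u₂, and any independent set meets {u₁, u₂} at most once.
-- Step (4) adds the new leaf u₁, which is safe because its neighbour u is red and
-- hence outside the set.

open import Defs
open import Data.Nat using (ℕ; zero; suc; _+_; _*_; _≤_; z≤n; s≤s; s≤s⁻¹; _≤?_)
open import Data.Nat.Properties
  using (+-suc; ≤-refl; ≤-trans; m≤n⇒m≤1+n; +-mono-≤; +-monoʳ-≤; +-comm; ≰⇒>; n≮n)
open import Data.Bool using (Bool; true; false; not)
open import Data.Fin using (Fin; zero; suc; fromℕ)
open import Data.Fin.Subset using (Subset; _∈_; ∣_∣)
open import Data.Vec using ([]; _∷_; lookup; here; there)
open import Data.Vec.Properties using (lookup⇒[]=)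
open import Data.List using (_∷_; map)
open import Data.List.Relation.Unary.Any using (here; there)
open import Data.List.Membership.Propositional.Properties using (∈-map⁺; ∈-map⁻)
import Data.List.Membership.Propositional as List
open import Data.Product using (Σ-syntax; _×_; _,_; proj₁)
open import Data.Sum using (inj₁; inj₂)
open import Relation.Nullary using (¬_; yes; no; contradiction)
open import Relation.Binary.PropositionalEquality using (_≡_; refl; sym; trans; subst; cong)

m+m≤1+n+n⇒m≤n : ∀ {m n} → m + m ≤ suc (n + n) → m ≤ n
m+m≤1+n+n⇒m≤n {m} {n} m+m≤1+n+n with m ≤? n
... | yes m≤n = m≤n
... | no m≰n = contradiction (subst (_≤ n + n) (+-suc n n) (s≤s⁻¹ 2+n+n≤1+n+n)) (n≮n (n + n))
  where
  2+n+n≤1+n+n : suc n + suc n ≤ suc (n + n)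
  2+n+n≤1+n+n = ≤-trans (+-mono-≤ (≰⇒> m≰n) (≰⇒> m≰n)) m+m≤1+n+n

m+m≤n+o⇒[1+m]+[1+m]≤[1+n]+[1+o] : ∀ {m n o} → m + m ≤ n + o → suc m + suc m ≤ suc n + suc o
m+m≤n+o⇒[1+m]+[1+m]≤[1+n]+[1+o] {m} {n} {o} p rewrite +-suc m m | +-suc n o = s≤s (s≤s p)

Independent-∷ : ∀ {n} {x y : Fin n} {E : Edges n} {S : Subset n} →
  ¬ (x ∈ S × y ∈ S) → Independent E S → Independent ((x , y) ∷ E) S
Independent-∷ ¬x,y∈S ind u v u∈S v∈S (inj₁ (here refl)) = ¬x,y∈S (u∈S , v∈S)
Independent-∷ ¬x,y∈S ind u v u∈S v∈S (inj₁ (there p))   = ind u v u∈S v∈S (inj₁ p)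
Independent-∷ ¬x,y∈S ind u v u∈S v∈S (inj₂ (here refl)) = ¬x,y∈S (v∈S , u∈S)
Independent-∷ ¬x,y∈S ind u v u∈S v∈S (inj₂ (there p))   = ind u v u∈S v∈S (inj₂ p)

Independent-tail : ∀ {n} {e} {E : Edges n} {S : Subset n} →
  Independent (e ∷ E) S → Independent E S
Independent-tail ind u v u∈S v∈S (inj₁ p) = ind u v u∈S v∈S (inj₁ (there p))
Independent-tail ind u v u∈S v∈S (inj₂ p) = ind u v u∈S v∈S (inj₂ (there p))

-- Defs relabels vertices by several syntactically distinct pattern-matching
-- lambdas, so the relabelling is abstracted to any f that acts as suc on both ends.
module Relabel {n : ℕ} {f : Fin n × Fin n → Fin (suc n) × Fin (suc n)}
               (f≡suc : ∀ a b → f (a , b) ≡ (suc a , suc b)) where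

  ∈-relabel⁺ : ∀ {E : Edges n} {u v} → (u , v) List.∈ E → (suc u , suc v) List.∈ map f E
  ∈-relabel⁺ {E} {u} {v} p = subst (List._∈ map f E) (f≡suc u v) (∈-map⁺ f p)

  ∈-relabel⁻ : ∀ {E : Edges n} {u v} → (suc u , suc v) List.∈ map f E → (u , v) List.∈ E
  ∈-relabel⁻ p with ∈-map⁻ f p
  ... | (a , b) , q , eq with trans eq (f≡suc a b)
  ... | refl = q

  zero∉relabelˡ : ∀ {E : Edges n} {y} → ¬ ((zero , y) List.∈ map f E)
  zero∉relabelˡ p with ∈-map⁻ f p
  ... | (a , b) , _ , eq with trans eq (f≡suc a b)
  ... | ()

  zero∉relabelʳ : ∀ {E : Edges n} {y} → ¬ ((y , zero) List.∈ map f E)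
  zero∉relabelʳ p with ∈-map⁻ f p
  ... | (a , b) , _ , eq with trans eq (f≡suc a b)
  ... | ()

  Independent-relabel⁺ : ∀ {E : Edges n} {S : Subset n} {c} →
    Independent E S → Independent (map f E) (c ∷ S)
  Independent-relabel⁺ ind zero    v       _ _ (inj₁ p) = zero∉relabelˡ p
  Independent-relabel⁺ ind zero    v       _ _ (inj₂ p) = zero∉relabelʳ p
  Independent-relabel⁺ ind (suc u) zero    _ _ (inj₁ p) = zero∉relabelʳ p
  Independent-relabel⁺ ind (suc u) zero    _ _ (inj₂ p) = zero∉relabelˡ p
  Independent-relabel⁺ ind (suc u) (suc v) (there u∈S) (there v∈S) (inj₁ p) =
    ind u v u∈S v∈S (inj₁ (∈-relabel⁻ p))
  Independent-relabel⁺ ind (suc u) (suc v) (there u∈S) (there v∈S) (inj₂ p) =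
    ind u v u∈S v∈S (inj₂ (∈-relabel⁻ p))

  Independent-relabel⁻ : ∀ {E : Edges n} {T : Subset n} {c} →
    Independent (map f E) (c ∷ T) → Independent E T
  Independent-relabel⁻ ind u v u∈T v∈T (inj₁ p) =
    ind (suc u) (suc v) (there u∈T) (there v∈T) (inj₁ (∈-relabel⁺ p))
  Independent-relabel⁻ ind u v u∈T v∈T (inj₂ p) =
    ind (suc u) (suc v) (there u∈T) (there v∈T) (inj₂ (∈-relabel⁺ p))

open Relabel

fromBool : Bool → ℕ
fromBool true  = 1
fromBool false = 0

path-independent-bound : ∀ j (T : Subset (suc j)) → Independent (pathEdges j) T →
  ∣ T ∣ + ∣ T ∣ ≤ j + (fromBool (lookup T zero) + fromBool (lookup T (fromℕ j)))
path-independent-bound zero (true ∷ [])  _ = ≤-refl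
path-independent-bound zero (false ∷ []) _ = z≤n
path-independent-bound (suc j) (a ∷ b ∷ T) ind
  with path-independent-bound j (b ∷ T) (Independent-relabel⁻ (λ _ _ → refl) (Independent-tail ind))
... | ih with a | b
... | true  | true  = contradiction (inj₁ (here refl)) (ind zero (suc zero) here (there here))
... | true  | false = m+m≤n+o⇒[1+m]+[1+m]≤[1+n]+[1+o] ih
... | false | false = m≤n⇒m≤1+n ih
... | false | true  = subst (∣ true ∷ T ∣ + ∣ true ∷ T ∣ ≤_) (+-suc j _) ih

alternating : ∀ j → Bool → Subset (suc j)
alternating zero    b = b ∷ []
alternating (suc j) b = b ∷ alternating j (not b)

zero∈alternating⇒true : ∀ j {b} → zero ∈ alternating j b → b ≡ true
zero∈alternating⇒true zero    here = refl
zero∈alternating⇒true (suc j) here = refl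

alternating-independent : ∀ j b → Independent (pathEdges j) (alternating j b)
alternating-independent zero    b u v _ _ (inj₁ ())
alternating-independent zero    b u v _ _ (inj₂ ())
alternating-independent (suc j) b =
  Independent-∷ ¬0,1∈S (Independent-relabel⁺ (λ _ _ → refl) (alternating-independent j (not b)))
  where
  ¬0,1∈S : ¬ (zero ∈ alternating (suc j) b × suc zero ∈ alternating (suc j) b)
  ¬0,1∈S (here , there 0∈rest) with zero∈alternating⇒true j 0∈rest
  ... | ()

alternating-size : ∀ j → j ≤ ∣ alternating j false ∣ + ∣ alternating j false ∣
                       × suc j ≤ ∣ alternating j true ∣ + ∣ alternating j true ∣
alternating-size zero = z≤n , s≤s z≤n
alternating-size (suc j) with alternating-size j
... | j≤2f , 1+j≤2t = 1+j≤2t , subst (suc (suc j) ≤_) (sym (cong suc (+-suc _ _))) (s≤s (s≤s j≤2f))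

cycle-alternating-independent : ∀ m → Independent (cycleEdges m) (alternating m false)
cycle-alternating-independent m =
  Independent-∷ (λ (_ , 0∈S) → 0∉S m 0∈S) (alternating-independent m false)
  where
  0∉S : ∀ m → ¬ (zero ∈ alternating m false)
  0∉S zero    ()
  0∉S (suc m) ()

fromBool+fromBool≤1 : ∀ a b → ¬ (a ≡ true × b ≡ true) → fromBool a + fromBool b ≤ 1
fromBool+fromBool≤1 true  true  ¬both = contradiction (refl , refl) ¬both
fromBool+fromBool≤1 true  false _     = ≤-refl
fromBool+fromBool≤1 false true  _     = ≤-refl
fromBool+fromBool≤1 false false _     = z≤n

cycle-independent-bound : ∀ m T → Independent (cycleEdges m) T → ∣ T ∣ ≤ ∣ alternating m false ∣
cycle-independent-bound m T ind = m+m≤1+n+n⇒m≤n (≤-trans 2∣T∣≤1+m (s≤s (proj₁ (alternating-size m))))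
  where
  ¬both-ends : ¬ (lookup T zero ≡ true × lookup T (fromℕ m) ≡ true)
  ¬both-ends (0∈T , m∈T) =
    ind zero (fromℕ m) (lookup⇒[]= zero T 0∈T) (lookup⇒[]= (fromℕ m) T m∈T) (inj₂ (here refl))
  2∣T∣≤1+m : ∣ T ∣ + ∣ T ∣ ≤ suc m
  2∣T∣≤1+m = subst (∣ T ∣ + ∣ T ∣ ≤_) (+-comm m 1)
    (≤-trans (path-independent-bound m T (Independent-tail ind))
             (+-monoʳ-≤ m (fromBool+fromBool≤1 _ _ ¬both-ends)))

record GoodMaximumIndependent {n} (E : Edges n) (col : Fin n → Colour) : Set where
  field
    S           : Subset n
    independent : Independent E S
    maximum     : ∀ T → Independent E T → ∣ T ∣ ≤ ∣ S ∣
    black⊆S     : ∀ v → col v ≡ black → v ∈ S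
    red∉S       : ∀ v → v ∈ S → ¬ col v ≡ red

open GoodMaximumIndependent

good-cycle : ∀ m → GoodMaximumIndependent (cycleEdges m) (λ _ → blue)
good-cycle m = record
  { S = alternating m false
  ; independent = cycle-alternating-independent m
  ; maximum = cycle-independent-bound m
  ; black⊆S = λ _ ()
  ; red∉S = λ _ _ ()
  }

good-pendantPath : ∀ {n E col} {col′ : Fin (suc (suc n)) → Colour} →
  GoodMaximumIndependent E col → (u : Fin n) →
  col′ zero ≡ red → col′ (suc zero) ≡ black → (∀ v → col′ (suc (suc v)) ≡ col v) →
  GoodMaximumIndependent ((suc (suc u) , zero) ∷ (zero , suc zero) ∷ shift 2 E) col′
good-pendantPath {col′ = col′} g u u₁-red u₂-black col′-old = record
  { S = false ∷ true ∷ S g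
  ; independent = Independent-∷ (λ { (_ , ()) }) (Independent-∷ (λ { (() , _) })
      (Independent-relabel⁺ (λ _ _ → refl) (Independent-relabel⁺ (λ _ _ → refl) (independent g))))
  ; maximum = bound
  ; black⊆S = black⊆S′
  ; red∉S = red∉S′
  }
  where
  bound : ∀ T → Independent _ T → ∣ T ∣ ≤ suc ∣ S g ∣
  bound (x ∷ y ∷ T) ind with maximum g T (Independent-relabel⁻ (λ _ _ → refl)
    (Independent-relabel⁻ (λ _ _ → refl) (Independent-tail (Independent-tail ind))))
  ... | ∣T∣≤∣S∣ with x | y
  ... | true  | true  = contradiction (inj₁ (there (here refl))) (ind zero (suc zero) here (there here))
  ... | true  | false = s≤s ∣T∣≤∣S∣
  ... | false | true  = s≤s ∣T∣≤∣S∣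
  ... | false | false = m≤n⇒m≤1+n ∣T∣≤∣S∣
  black⊆S′ : ∀ v → col′ v ≡ black → v ∈ (false ∷ true ∷ S g)
  black⊆S′ zero          is-black = contradiction (trans (sym u₁-red) is-black) λ ()
  black⊆S′ (suc zero)    _        = there here
  black⊆S′ (suc (suc v)) is-black = there (there (black⊆S g v (trans (sym (col′-old v)) is-black)))
  red∉S′ : ∀ v → v ∈ (false ∷ true ∷ S g) → ¬ col′ v ≡ red
  red∉S′ (suc zero)    _                   is-red = contradiction (trans (sym u₂-black) is-red) λ ()
  red∉S′ (suc (suc v)) (there (there v∈S)) is-red = red∉S g v v∈S (trans (sym (col′-old v)) is-red)

good-pendantAtRed : ∀ {n E col} {col′ : Fin (suc n) → Colour} →
  GoodMaximumIndependent E col → (u : Fin n) → col u ≡ red →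
  col′ zero ≡ black → (∀ v → col′ (suc v) ≡ col v) →
  GoodMaximumIndependent ((suc u , zero) ∷ shift 1 E) col′
good-pendantAtRed {col′ = col′} g u u-red u₁-black col′-old = record
  { S = true ∷ S g
  ; independent = Independent-∷ (λ { (there u∈S , _) → red∉S g u u∈S u-red })
      (Independent-relabel⁺ (λ _ _ → refl) (independent g))
  ; maximum = bound
  ; black⊆S = black⊆S′
  ; red∉S = red∉S′
  }
  where
  bound : ∀ T → Independent _ T → ∣ T ∣ ≤ suc ∣ S g ∣
  bound (x ∷ T) ind with maximum g T (Independent-relabel⁻ (λ _ _ → refl) (Independent-tail ind))
  ... | ∣T∣≤∣S∣ with x
  ... | true  = s≤s ∣T∣≤∣S∣
  ... | false = m≤n⇒m≤1+n ∣T∣≤∣S∣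
  black⊆S′ : ∀ v → col′ v ≡ black → v ∈ (true ∷ S g)
  black⊆S′ zero    _        = here
  black⊆S′ (suc v) is-black = there (black⊆S g v (trans (sym (col′-old v)) is-black))
  red∉S′ : ∀ v → v ∈ (true ∷ S g) → ¬ col′ v ≡ red
  red∉S′ zero    _           is-red = contradiction (trans (sym u₁-black) is-red) λ ()
  red∉S′ (suc v) (there v∈S) is-red = red∉S g v v∈S (trans (sym (col′-old v)) is-red)

good-built : ∀ {n E col} → Built n E col → GoodMaximumIndependent E col
good-built (cycle k)         = good-cycle (suc (suc (2 * k)))
good-built (step3 b u)       = good-pendantPath (good-built b) u refl refl λ _ → refl
good-built (step4 b u u-red) = good-pendantAtRed (good-built b) u u-red refl λ _ → refl

theorem4p3 : ∀ (n : ℕ) (E : Edges n) (col : Fin n → Colour) → Built n E col →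
    Σ[ S ∈ Subset n ] (MaximumIndependent E S × (∀ v → col v ≡ black → v ∈ S))
theorem4p3 n E col b = S g , (independent g , maximum g) , black⊆S g
  where g = good-built b
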